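{- For $r = 2$ and $r = 3$, we have $\mathrm{sat}(n, C_{r+1}, B_{r,r}) = 0$ for all $n \ge 2r$.
   Context: $B_{r,r}$ (the "dumb-bell") is the disjoint union of two copies of $K_r$ together with one edge joining a vertex of one copy to a vertex of the other. A graph $G$ is $F$-saturated if $G$ contains no copy of $F$ but adding any edge to $G$ creates a copy of $F$. $\mathrm{sat}(n,H,F)$ is the minimum number of copies of $H$ in an $n$-vertex $F$-saturated graph. $C_t$ is the cycle of length $t$. -}

module Defs where

open import Data.Nat using (ℕ; zero; suc; _+_; _∸_; _<ᵇ_; _≡ᵇ_)
open import Data.Fin using (Fin; toℕ; _≟_)
open import Data.Bool using (Bool; true; false; _∧_; _∨_; not)
open import Data.Product using (Σ; ∃; ∃-syntax; _×_; _,_)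
open import Relation.Binary.PropositionalEquality using (_≡_; _≢_; refl; cong; cong₂; sym)
open import Relation.Nullary using (yes; no)
open import Data.Bool.Properties using (∨-comm)
open import Relation.Nullary using (¬_)
open import Relation.Nullary.Decidable using (⌊_⌋)
open import Function.Definitions using (Injective)
import Data.Empty

record Graph (n : ℕ) : Set where
  field
    adj   : Fin n → Fin n → Bool
    symm  : ∀ x y → adj x y ≡ adj y x
    irrefl : ∀ x → adj x x ≡ false
open Graph public

adjWith : ∀ {n} → Graph n → Fin n → Fin n → Fin n → Fin n → Bool
adjWith G u v x y =
  adj G x y ∨ (⌊ x ≟ u ⌋ ∧ ⌊ y ≟ v ⌋) ∨ (⌊ x ≟ v ⌋ ∧ ⌊ y ≟ u ⌋)

HasCopyIn : ∀ {k n} → Graph k → (Fin n → Fin n → Bool) → Set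
HasCopyIn {k} {n} H A =
  Σ (Fin k → Fin n) λ f →
    Injective _≡_ _≡_ f × (∀ i j → adj H i j ≡ true → A (f i) (f j) ≡ true)

HasCopy : ∀ {k n} → Graph k → Graph n → Set
HasCopy H G = HasCopyIn H (adj G)

Saturated : ∀ {k n} → Graph k → Graph n → Set
Saturated F G =
  ¬ HasCopy F G ×
  (∀ u v → u ≢ v → adj G u v ≡ false → HasCopyIn F (adjWith G u v))

-- The cycle C_t on vertices 0,…,t-1 (i ~ i+1, and t-1 ~ 0); intended t ≥ 3.

cycAdjℕ : ℕ → ℕ → ℕ → Bool
cycAdjℕ t i j =
  (suc i ≡ᵇ j) ∨ (suc j ≡ᵇ i) ∨
  ((i ≡ᵇ 0) ∧ (j ≡ᵇ (t ∸ 1)) ∧ not (j ≡ᵇ 0)) ∨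
  ((j ≡ᵇ 0) ∧ (i ≡ᵇ (t ∸ 1)) ∧ not (i ≡ᵇ 0))

-- The dumb-bell B_{r,r} on vertices 0,…,2r-1: {0..r-1} and {r..2r-1} are
-- cliques, plus the single edge joining vertex 0 and vertex r.
dumbAdjℕ : ℕ → ℕ → ℕ → Bool
dumbAdjℕ r i j =
  not (i ≡ᵇ j) ∧
  ( ((i <ᵇ r) ∧ (j <ᵇ r))
  ∨ (not (i <ᵇ r) ∧ not (j <ᵇ r))
  ∨ ((i ≡ᵇ 0) ∧ (j ≡ᵇ r))
  ∨ ((j ≡ᵇ 0) ∧ (i ≡ᵇ r)) )

-- Building a simple graph from an arbitrary Bool relation R on vertex
-- labels: x ~ y iff x ≠ y and (R x y or R y x).  (For the symmetric,
-- loop-free relations below this does not change the edge set.)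

private
  eqB : ∀ {n} → Fin n → Fin n → Bool
  eqB x y = ⌊ x ≟ y ⌋

  eqB-sym : ∀ {n} (x y : Fin n) → eqB x y ≡ eqB y x
  eqB-sym x y with x ≟ y | y ≟ x
  ... | yes _ | yes _ = refl
  ... | no _  | no _  = refl
  ... | yes p | no q  = Data.Empty.⊥-elim (q (sym p))
  ... | no p  | yes q = Data.Empty.⊥-elim (p (sym q))

  eqB-refl : ∀ {n} (x : Fin n) → eqB x x ≡ true
  eqB-refl x with x ≟ x
  ... | yes _ = refl
  ... | no p  = Data.Empty.⊥-elim (p refl)

mkGraph : ∀ {n} → (ℕ → ℕ → Bool) → Graph n
mkGraph R = record
  { adj    = λ x y → not (eqB x y) ∧ (R (toℕ x) (toℕ y) ∨ R (toℕ y) (toℕ x))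
  ; symm   = λ x y → cong₂ (λ a b → not a ∧ b) (eqB-sym x y)
                       (∨-comm (R (toℕ x) (toℕ y)) (R (toℕ y) (toℕ x)))
  ; irrefl = λ x → cong (λ a → not a ∧ (R (toℕ x) (toℕ x) ∨ R (toℕ x) (toℕ x))) (eqB-refl x)
  }

Cycle : (t : ℕ) → Graph t
Cycle t = mkGraph (cycAdjℕ t)

Dumbbell : (r : ℕ) → Graph (r + r)
Dumbbell r = mkGraph (dumbAdjℕ r)

-- For r = 2 take the star K_{1,n-1}: it has no triangle and no path on four vertices
-- (which is B_{2,2}), and joining two leaves x, y creates the path z – hub – x – y.
-- For r = 3 write n = 3K + e with K ≥ 2 and e ≤ 2, and take K disjoint triangles
-- together with e apices, each apex joined to one corner of every triangle, where two
-- apices share exactly one common neighbour.  The only triangles are the K given ones,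
-- so no two triangles are joined by an edge and there is no B_{3,3}; two vertices never
-- have two common neighbours, so there is no C_4; and every new edge closes a triangle
-- which an apex or the new edge bridges to another triangle.  In both cases the copy of
-- B_{r,r} is assembled from two disjoint r-cliques and an edge between their first vertices.

module Submission where

open import Defs
open import Data.Nat using (ℕ; _+_; _*_; _≤_)
open import Data.Sum using (_⊎_)
open import Data.Product using (∃-syntax; Σ-syntax; _×_)
open import Relation.Binary.PropositionalEquality using (_≡_)
open import Relation.Nullary using (¬_)

open import Data.Bool using (true; false; T; not; _∧_; _∨_)
open import Data.Bool.Properties using (∨-zeroʳ; T-≡; T-∧; T-∨)
open import Data.Empty using (⊥; ⊥-elim)
open import Data.Fin using (Fin; zero; suc; toℕ; inject≤; _≟_; _↑ˡ_; _↑ʳ_; splitAt; join)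
open import Data.Fin.Patterns using (0F; 1F; 2F; 3F; 4F; 5F)
open import Data.Fin.Permutation.Components using (transpose; transpose-inverse)
open import Data.Fin.Properties
  using (suc-injective; injective⇒≤; inject≤-injective; +↔⊎; *↔×; toℕ-injective; toℕ<n;
         toℕ-↑ˡ; toℕ-↑ʳ; join-splitAt)
open import Data.Nat using (zero; suc; _<_; s≤s)
open import Data.Nat.DivMod using (_/_; _%_; m%n<n; m≡m%n+[m/n]*n)
open import Data.Nat.Properties
  using (m≤n⇒∃[o]m+o≡n; ≤-pred; +-comm; m≤m+n; <ᵇ⇒<; <⇒<ᵇ; ≡ᵇ⇒≡; <⇒≱; <-irrefl;
         +-cancelˡ-≡; +-identityʳ)
open import Data.Product using (_,_; proj₁; proj₂; ∃₂)
open import Data.Sum using (inj₁; inj₂; [_,_]′)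
open import Data.Sum.Properties using (inj₂-injective)
open import Data.Sum.Function.Propositional using (_⊎-↔_)
open import Data.Vec using (Vec; []; _∷_; lookup)
open import Data.Vec.Relation.Unary.All using ([]; _∷_)
open import Data.Vec.Relation.Unary.All.Properties using (lookup⁺)
open import Data.Vec.Relation.Unary.AllPairs as AllPairs using (AllPairs; []; _∷_)
open import Data.Vec.Relation.Unary.Unique.Propositional.Properties using (lookup-injective)
open import Function using (_∘_; _↔_; Inverse; Injection; mk⇔; Equivalence)
open import Function.Properties.Inverse using (↔-refl; ↔-sym; ↔-trans; ↔⇒↣)
open import Function.Definitions using (Injective)
open import Relation.Binary.Definitions using (Decidable; Symmetric)
open import Relation.Binary.PropositionalEquality using (_≢_; refl; sym; trans; cong; subst; subst₂)
open import Relation.Nullary using (yes; no; does)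
open import Relation.Nullary.Decidable using (⌊_⌋; map′; dec-true; dec-false; does-⇔)

-- Graphs given by a relation on an arbitrary vertex type

record HasCopyᴿ {k} {V : Set} (H : Graph k) (_~_ : V → V → Set) : Set where
  constructor copy
  field
    vertex    : Fin k → V
    injective : Injective _≡_ _≡_ vertex
    edge      : ∀ i j → adj H i j ≡ true → vertex i ~ vertex j

copy-mono : ∀ {k} {V : Set} {H : Graph k} {R S : V → V → Set} →
  (∀ {x y} → R x y → S x y) → HasCopyᴿ H R → HasCopyᴿ H S
copy-mono R⇒S (copy f f-inj f-edge) = copy f f-inj λ i j e → R⇒S (f-edge i j e)

data WithEdge {V : Set} (_~_ : V → V → Set) (u v : V) : V → V → Set where
  old   : ∀ {x y} → x ~ y → WithEdge _~_ u v x y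
  new   : WithEdge _~_ u v u v
  new⁻¹ : WithEdge _~_ u v v u

module _ {V : Set} {_~_ : V → V → Set} where

  WithEdge-sym : ∀ {u v} → Symmetric _~_ → Symmetric (WithEdge _~_ u v)
  WithEdge-sym ~-sym (old x~y) = old (~-sym x~y)
  WithEdge-sym ~-sym new       = new⁻¹
  WithEdge-sym ~-sym new⁻¹     = new

  WithEdge-swap : ∀ {u v x y} → WithEdge _~_ u v x y → WithEdge _~_ v u x y
  WithEdge-swap (old x~y) = old x~y
  WithEdge-swap new       = new⁻¹
  WithEdge-swap new⁻¹     = new

Saturatedᴿ : ∀ {k} {V : Set} → Graph k → (V → V → Set) → Set
Saturatedᴿ F _~_ =
  ¬ HasCopyᴿ F _~_ × (∀ {u v} → u ≢ v → ¬ u ~ v → HasCopyᴿ F (WithEdge _~_ u v))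

module _ {n} (G : Graph n) (u v : Fin n) where

  adjWith-old : ∀ {x y} → adj G x y ≡ true → adjWith G u v x y ≡ true
  adjWith-old x~y rewrite x~y = refl

  adjWith-new : adjWith G u v u v ≡ true
  adjWith-new with u ≟ u | v ≟ v
  ... | yes _  | yes _  = ∨-zeroʳ (adj G u v)
  ... | no u≢u | _      = ⊥-elim (u≢u refl)
  ... | _      | no v≢v = ⊥-elim (v≢v refl)

  adjWith-new⁻¹ : adjWith G u v v u ≡ true
  adjWith-new⁻¹ with v ≟ v | u ≟ u
  ... | yes _  | yes _  rewrite ∨-zeroʳ (⌊ v ≟ u ⌋ ∧ ⌊ u ≟ v ⌋) = ∨-zeroʳ (adj G v u)
  ... | no v≢v | _      = ⊥-elim (v≢v refl)
  ... | _      | no u≢u = ⊥-elim (u≢u refl)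

module Relabel {N} {V : Set} {_~_ : V → V → Set} (_~?_ : Decidable _~_)
  (~-sym : Symmetric _~_) (~-irrefl : ∀ {x} → ¬ x ~ x) (label : Fin N ↔ V) where

  open Inverse label using (to; from; strictlyInverseˡ; strictlyInverseʳ)

  graph : Graph N
  graph = record
    { adj    = λ x y → does (to x ~? to y)
    ; symm   = λ x y → does-⇔ (mk⇔ ~-sym ~-sym) (to x ~? to y) (to y ~? to x)
    ; irrefl = λ x → dec-false (to x ~? to x) ~-irrefl
    }

  adj⇒~ : ∀ {x y} → adj graph x y ≡ true → to x ~ to y
  adj⇒~ {x} {y} with to x ~? to y
  ... | yes x~y = λ _ → x~y

  nonadj⇒≁ : ∀ {x y} → adj graph x y ≡ false → ¬ to x ~ to y
  nonadj⇒≁ {x} {y} with to x ~? to y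
  ... | no x≁y = λ _ → x≁y

  ~⇒adj : ∀ {a b} → a ~ b → adj graph (from a) (from b) ≡ true
  ~⇒adj {a} {b} a~b = dec-true (to (from a) ~? to (from b))
    (subst₂ _~_ (sym (strictlyInverseˡ a)) (sym (strictlyInverseˡ b)) a~b)

  to-injective : Injective _≡_ _≡_ to
  to-injective = Injection.injective (↔⇒↣ label)

  from-injective : Injective _≡_ _≡_ from
  from-injective = Injection.injective (↔⇒↣ (↔-sym label))

  copy-free : ∀ {k} {H : Graph k} → ¬ HasCopyᴿ H _~_ → ¬ HasCopy H graph
  copy-free no-copy (f , f-inj , f-edge) =
    no-copy (copy (to ∘ f) (f-inj ∘ to-injective) λ i j e → adj⇒~ (f-edge i j e))

  copy-with-edge : ∀ {k} {H : Graph k} u v →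
    HasCopyᴿ H (WithEdge _~_ (to u) (to v)) → HasCopyIn H (adjWith graph u v)
  copy-with-edge u v (copy g g-inj g-edge) =
    from ∘ g , g-inj ∘ from-injective , λ i j e → edge (g-edge i j e)
    where
    edge : ∀ {a b} → WithEdge _~_ (to u) (to v) a b → adjWith graph u v (from a) (from b) ≡ true
    edge (old a~b) = adjWith-old graph u v (~⇒adj a~b)
    edge new   rewrite strictlyInverseʳ u | strictlyInverseʳ v = adjWith-new graph u v
    edge new⁻¹ rewrite strictlyInverseʳ u | strictlyInverseʳ v = adjWith-new⁻¹ graph u v

  saturated : ∀ {k} {F : Graph k} → Saturatedᴿ F _~_ → Saturated F graph
  saturated {F = F} (no-copy , add-edge) =
    copy-free {H = F} no-copy ,
    λ u v u≢v u≁v → copy-with-edge {H = F} u v (add-edge (u≢v ∘ to-injective) (nonadj⇒≁ u≁v))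

-- Cliques and dumb-bells

record IsClique {r} {V : Set} (_~_ : V → V → Set) (g : Fin r → V) : Set where
  constructor clique
  field
    injective : Injective _≡_ _≡_ g
    adjacent  : ∀ {x y} → x ≢ y → g x ~ g y

clique-mono : ∀ {r} {V : Set} {R S : V → V → Set} {g : Fin r → V} →
  (∀ {x y} → R x y → S x y) → IsClique R g → IsClique S g
clique-mono R⇒S (clique g-inj g-adj) = clique g-inj (R⇒S ∘ g-adj)

lookup-clique : ∀ {r} {V : Set} {_~_ : V → V → Set} → Symmetric _~_ →
  {xs : Vec V r} → AllPairs (λ a b → a ≢ b × a ~ b) xs → IsClique _~_ (lookup xs)
lookup-clique {_~_ = _~_} ~-sym ps = clique (lookup-injective (AllPairs.map proj₁ ps) _ _) (adjacent ps)
  where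
  adjacent : ∀ {r} {xs : Vec _ r} → AllPairs (λ a b → a ≢ b × a ~ b) xs →
    ∀ {i j} → i ≢ j → lookup xs i ~ lookup xs j
  adjacent (p ∷ ps) {zero}  {zero}  i≢j = ⊥-elim (i≢j refl)
  adjacent (p ∷ ps) {zero}  {suc j} _   = proj₂ (lookup⁺ p j)
  adjacent (p ∷ ps) {suc i} {zero}  _   = ~-sym (proj₂ (lookup⁺ p i))
  adjacent (p ∷ ps) {suc i} {suc j} i≢j = adjacent ps (i≢j ∘ cong suc)

adj⇒≢ : ∀ {n} (G : Graph n) {i j} → adj G i j ≡ true → i ≢ j
adj⇒≢ G {i} i~j refl with () ← trans (sym i~j) (irrefl G i)

private
  T-∧-elim : ∀ {x y} → T (x ∧ y) → T x × T y
  T-∧-elim = Equivalence.to T-∧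

  T-∨-elim : ∀ {x y} → T (x ∨ y) → T x ⊎ T y
  T-∨-elim = Equivalence.to T-∨

  T-not-elim : ∀ {x} → T (not x) → ¬ T x
  T-not-elim {false} _ ()

dumbAdjℕ-cases : ∀ r a b → T (dumbAdjℕ r a b) →
  (a < r × b < r) ⊎ (¬ a < r × ¬ b < r) ⊎ (a ≡ 0 × b ≡ r) ⊎ (b ≡ 0 × a ≡ r)
dumbAdjℕ-cases r a b p with T-∨-elim (proj₂ (T-∧-elim p))
... | inj₁ q with a<r , b<r ← T-∧-elim q = inj₁ (<ᵇ⇒< a r a<r , <ᵇ⇒< b r b<r)
... | inj₂ q with T-∨-elim q
...   | inj₁ q′ with a≮r , b≮r ← T-∧-elim q′ =
        inj₂ (inj₁ (T-not-elim a≮r ∘ <⇒<ᵇ , T-not-elim b≮r ∘ <⇒<ᵇ))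
...   | inj₂ q′ with T-∨-elim q′
...     | inj₁ q″ with a≡0 , b≡r ← T-∧-elim q″ = inj₂ (inj₂ (inj₁ (≡ᵇ⇒≡ a 0 a≡0 , ≡ᵇ⇒≡ b r b≡r)))
...     | inj₂ q″ with b≡0 , a≡r ← T-∧-elim q″ = inj₂ (inj₂ (inj₂ (≡ᵇ⇒≡ b 0 b≡0 , ≡ᵇ⇒≡ a r a≡r)))

dumbAdjℕ-across : ∀ {r a b} → a < r → r ≤ b → T (dumbAdjℕ r a b ∨ dumbAdjℕ r b a) → a ≡ 0 × b ≡ r
dumbAdjℕ-across {r} {a} {b} a<r r≤b p with T-∨-elim p
... | inj₁ q with dumbAdjℕ-cases r a b q
...   | inj₁ (_ , b<r)               = ⊥-elim (<⇒≱ b<r r≤b)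
...   | inj₂ (inj₁ (a≮r , _))        = ⊥-elim (a≮r a<r)
...   | inj₂ (inj₂ (inj₁ a≡0,b≡r))   = a≡0,b≡r
...   | inj₂ (inj₂ (inj₂ (_ , a≡r))) = ⊥-elim (<-irrefl a≡r a<r)
dumbAdjℕ-across {r} {a} {b} a<r r≤b p | inj₂ q with dumbAdjℕ-cases r b a q
...   | inj₁ (b<r , _)               = ⊥-elim (<⇒≱ b<r r≤b)
...   | inj₂ (inj₁ (_ , a≮r))        = ⊥-elim (a≮r a<r)
...   | inj₂ (inj₂ (inj₁ (_ , a≡r))) = ⊥-elim (<-irrefl a≡r a<r)
...   | inj₂ (inj₂ (inj₂ a≡0,b≡r))   = a≡0,b≡r

dumbbell-bridge : ∀ {k} (x y : Fin (suc k)) →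
  adj (Dumbbell (suc k)) (x ↑ˡ suc k) (suc k ↑ʳ y) ≡ true → x ≡ zero × y ≡ zero
dumbbell-bridge {k} x y p with dumbAdjℕ-across (toℕ<n x) (m≤m+n (suc k) (toℕ y)) across
  where
  across : T (dumbAdjℕ (suc k) (toℕ x) (suc k + toℕ y) ∨ dumbAdjℕ (suc k) (suc k + toℕ y) (toℕ x))
  across = subst₂ (λ a b → T (dumbAdjℕ (suc k) a b ∨ dumbAdjℕ (suc k) b a))
             (toℕ-↑ˡ x (suc k)) (toℕ-↑ʳ (suc k) y) (proj₂ (T-∧-elim (Equivalence.from T-≡ p)))
... | x≡0 , r+y≡r =
  toℕ-injective x≡0 , toℕ-injective (+-cancelˡ-≡ (suc k) (toℕ y) 0 (trans r+y≡r (sym (+-identityʳ (suc k)))))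

module _ {V : Set} {_~_ : V → V → Set} (~-sym : Symmetric _~_) {k} {g h : Fin (suc k) → V} where

  dumbbell-copy : IsClique _~_ g → IsClique _~_ h → (∀ x y → g x ≢ h y) → g zero ~ h zero →
    HasCopyᴿ (Dumbbell (suc k)) _~_
  dumbbell-copy (clique g-inj g-adj) (clique h-inj h-adj) g≢h g₀~h₀ = copy f f-inj f-edge
    where
    r : ℕ
    r = suc k

    f : Fin (r + r) → V
    f = [ g , h ]′ ∘ splitAt r

    splitAt⁻¹ : ∀ {i s} → splitAt r i ≡ s → i ≡ join r r s
    splitAt⁻¹ {i} eq = trans (sym (join-splitAt r r i)) (cong (join r r) eq)

    splitAt-injective : Injective _≡_ _≡_ (splitAt r {r})
    splitAt-injective eq = trans (splitAt⁻¹ eq) (sym (splitAt⁻¹ refl))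

    [g,h]-injective : Injective _≡_ _≡_ [ g , h ]′
    [g,h]-injective {inj₁ x} {inj₁ y} eq = cong inj₁ (g-inj eq)
    [g,h]-injective {inj₁ x} {inj₂ y} eq = ⊥-elim (g≢h x y eq)
    [g,h]-injective {inj₂ x} {inj₁ y} eq = ⊥-elim (g≢h y x (sym eq))
    [g,h]-injective {inj₂ x} {inj₂ y} eq = cong inj₂ (h-inj eq)

    f-inj : Injective _≡_ _≡_ f
    f-inj = splitAt-injective ∘ [g,h]-injective

    f-edge : ∀ i j → adj (Dumbbell r) i j ≡ true → f i ~ f j
    f-edge i j i~j with splitAt r i in eqᵢ | splitAt r j in eqⱼ
    ... | inj₁ x | inj₁ y = g-adj λ x≡y → adj⇒≢ (Dumbbell r) {i} {j} i~j
                              (splitAt-injective {i} {j} (trans eqᵢ (trans (cong inj₁ x≡y) (sym eqⱼ))))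
    ... | inj₂ x | inj₂ y = h-adj λ x≡y → adj⇒≢ (Dumbbell r) {i} {j} i~j
                              (splitAt-injective {i} {j} (trans eqᵢ (trans (cong inj₂ x≡y) (sym eqⱼ))))
    ... | inj₁ x | inj₂ y
      with refl , refl ← dumbbell-bridge x y
             (subst₂ (λ a b → adj (Dumbbell r) a b ≡ true) (splitAt⁻¹ {i} eqᵢ) (splitAt⁻¹ {j} eqⱼ) i~j)
      = g₀~h₀
    ... | inj₂ x | inj₁ y
      with refl , refl ← dumbbell-bridge y x
             (subst₂ (λ a b → adj (Dumbbell r) a b ≡ true) (splitAt⁻¹ {j} eqⱼ) (splitAt⁻¹ {i} eqᵢ)
               (trans (symm (Dumbbell r) j i) i~j))
      = ~-sym g₀~h₀

codegree≤1⇒C4-free : ∀ {V : Set} {_~_ : V → V → Set} →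
  (∀ {x y w w′} → x ≢ y → x ~ w → y ~ w → x ~ w′ → y ~ w′ → w ≡ w′) → ¬ HasCopyᴿ (Cycle 4) _~_
codegree≤1⇒C4-free codegree≤1 (copy f f-inj f-edge) =
  1≢3 (f-inj (codegree≤1 (0≢2 ∘ f-inj)
    (f-edge 0F 1F refl) (f-edge 2F 1F refl) (f-edge 0F 3F refl) (f-edge 2F 3F refl)))
  where
  0≢2 : 0F ≢ 2F
  0≢2 ()
  1≢3 : 1F ≢ 3F
  1≢3 ()

-- The star (r = 2)

data _⋆_ {n : ℕ} : Fin (suc n) → Fin (suc n) → Set where
  hub-leaf : ∀ {x} → zero ⋆ suc x
  leaf-hub : ∀ {x} → suc x ⋆ zero

module Star {n : ℕ} where

  _⋆?_ : Decidable (_⋆_ {n})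
  zero  ⋆? zero  = no λ ()
  zero  ⋆? suc _ = yes hub-leaf
  suc _ ⋆? zero  = yes leaf-hub
  suc _ ⋆? suc _ = no λ ()

  ⋆-sym : Symmetric (_⋆_ {n})
  ⋆-sym hub-leaf = leaf-hub
  ⋆-sym leaf-hub = hub-leaf

  ⋆-irrefl : ∀ {x : Fin (suc n)} → ¬ x ⋆ x
  ⋆-irrefl ()

  triangle-free : ¬ HasCopyᴿ (Cycle 3) (_⋆_ {n})
  triangle-free (copy f _ f-edge) = no-triangle (f-edge 0F 1F refl) (f-edge 1F 2F refl) (f-edge 0F 2F refl)
    where
    no-triangle : ∀ {x y z} → x ⋆ y → y ⋆ z → x ⋆ z → ⊥
    no-triangle hub-leaf leaf-hub ()
    no-triangle leaf-hub hub-leaf ()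

  path-free : ¬ HasCopyᴿ (Dumbbell 2) (_⋆_ {n})
  path-free (copy f f-inj f-edge) =
    no-path (f-edge 0F 1F refl) (f-edge 2F 3F refl) (f-edge 0F 2F refl) ((λ ()) ∘ f-inj) ((λ ()) ∘ f-inj)
    where
    no-path : ∀ {w x y z} → w ⋆ x → y ⋆ z → w ⋆ y → x ≢ y → w ≢ z → ⊥
    no-path hub-leaf leaf-hub hub-leaf _   w≢z = w≢z refl
    no-path leaf-hub _        leaf-hub x≢y _   = x≢y refl

avoid-two : ∀ {m} (x y : Fin (3 + m)) → ∃[ z ] z ≢ x × z ≢ y
avoid-two 0F            0F            = 1F , (λ ()) , (λ ())
avoid-two 0F            1F            = 2F , (λ ()) , (λ ())
avoid-two 0F            (suc (suc _)) = 1F , (λ ()) , (λ ())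
avoid-two 1F            0F            = 2F , (λ ()) , (λ ())
avoid-two 1F            (suc _)       = 0F , (λ ()) , (λ ())
avoid-two (suc (suc _)) 0F            = 1F , (λ ()) , (λ ())
avoid-two (suc (suc _)) (suc _)       = 0F , (λ ()) , (λ ())

module _ {m : ℕ} where
  open Star {3 + m}

  star-saturated : Saturatedᴿ (Dumbbell 2) (_⋆_ {3 + m})
  star-saturated = path-free , add-edge
    where
    add-edge : ∀ {u v} → u ≢ v → ¬ u ⋆ v → HasCopyᴿ (Dumbbell 2) (WithEdge _⋆_ u v)
    add-edge {0F}    {0F}    u≢v _   = ⊥-elim (u≢v refl)
    add-edge {0F}    {suc _} _   u≁v = ⊥-elim (u≁v hub-leaf)
    add-edge {suc _} {0F}    _   u≁v = ⊥-elim (u≁v leaf-hub)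
    add-edge {suc x} {suc y} u≢v _ with z , z≢x , z≢y ← avoid-two x y =
      dumbbell-copy ⋆⁺-sym (lookup-clique ⋆⁺-sym {spoke} ((((λ ()) , old hub-leaf) ∷ []) ∷ [] ∷ []))
                           (lookup-clique ⋆⁺-sym {added} (((u≢v , new) ∷ []) ∷ [] ∷ []))
                    disjoint (old hub-leaf)
      where
      ⋆⁺-sym : Symmetric (WithEdge _⋆_ (suc x) (suc y))
      ⋆⁺-sym = WithEdge-sym ⋆-sym

      spoke added : Vec (Fin (4 + m)) 2
      spoke = 0F ∷ suc z ∷ []
      added = suc x ∷ suc y ∷ []

      disjoint : ∀ i j → lookup spoke i ≢ lookup added j
      disjoint 0F 0F = λ ()
      disjoint 0F 1F = λ ()
      disjoint 1F 0F = z≢x ∘ suc-injective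
      disjoint 1F 1F = z≢y ∘ suc-injective

star-graph : ∀ {n} → 4 ≤ n → Σ[ G ∈ Graph n ] (Saturated (Dumbbell 2) G × ¬ HasCopy (Cycle 3) G)
star-graph (s≤s (s≤s (s≤s (s≤s {n = m} _)))) = graph , saturated star-saturated , copy-free triangle-free
  where
  open Star {3 + m}
  open Relabel _⋆?_ ⋆-sym ⋆-irrefl ↔-refl

-- Triangles with apices (r = 3)

Fin3-third-unique : ∀ {a b c d : Fin 3} → a ≢ b → a ≢ c → b ≢ c → a ≢ d → b ≢ d → c ≡ d
Fin3-third-unique {a} {b} {c} {d} a≢b a≢c b≢c a≢d b≢d with c ≟ d
... | yes c≡d = c≡d
... | no  c≢d = ⊥-elim (4≰3 (injective⇒≤ (lookup-injective distinct _ _)))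
  where
  distinct : AllPairs _≢_ (a ∷ b ∷ c ∷ d ∷ [])
  distinct = (a≢b ∷ a≢c ∷ a≢d ∷ []) ∷ (b≢c ∷ b≢d ∷ []) ∷ (c≢d ∷ []) ∷ [] ∷ []
  4≰3 : ¬ 4 ≤ 3
  4≰3 (s≤s (s≤s (s≤s ())))

transpose-injective : ∀ {n} (i j : Fin n) → Injective _≡_ _≡_ (transpose i j)
transpose-injective i j {x} {y} eq =
  trans (sym (transpose-inverse j i)) (trans (cong (transpose j i) eq) (transpose-inverse j i))

-- inj₁ (j , a) is corner a of triangle j; inj₂ s is an apex, joined to corner T s j of every triangle j.
module Triangles {K e : ℕ} (T : Fin e → Fin K → Fin 3)
  (common : ∀ s t → ∃[ j ] T s j ≡ T t j)
  (common-unique : ∀ {s t j j′} → s ≢ t → T s j ≡ T t j → T s j′ ≡ T t j′ → j ≡ j′)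
  (other : Fin K → Fin K) (other-≢ : ∀ j → other j ≢ j) where

  Vertex : Set
  Vertex = (Fin K × Fin 3) ⊎ Fin e

  data _~_ : Vertex → Vertex → Set where
    side    : ∀ {j a b} → a ≢ b → inj₁ (j , a) ~ inj₁ (j , b)
    spoke   : ∀ {s j a} → T s j ≡ a → inj₂ s ~ inj₁ (j , a)
    spoke⁻¹ : ∀ {s j a} → T s j ≡ a → inj₁ (j , a) ~ inj₂ s

  _~?_ : Decidable _~_
  inj₁ (j , a) ~? inj₁ (j′ , b) with j ≟ j′ | a ≟ b
  ... | yes refl | no a≢b   = yes (side a≢b)
  ... | yes refl | yes refl = no λ { (side a≢a) → a≢a refl }
  ... | no j≢j′  | _        = no λ { (side _) → j≢j′ refl }
  inj₁ (j , a) ~? inj₂ s = map′ spoke⁻¹ (λ { (spoke⁻¹ p) → p }) (T s j ≟ a)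
  inj₂ s ~? inj₁ (j , a) = map′ spoke (λ { (spoke p) → p }) (T s j ≟ a)
  inj₂ _ ~? inj₂ _ = no λ ()

  ~-sym : Symmetric _~_
  ~-sym (side a≢b)  = side (a≢b ∘ sym)
  ~-sym (spoke p)   = spoke⁻¹ p
  ~-sym (spoke⁻¹ p) = spoke p

  ~-irrefl : ∀ {x} → ¬ x ~ x
  ~-irrefl (side a≢a) = a≢a refl

  data InTriangle (j : Fin K) : Vertex → Set where
    corner : ∀ a → InTriangle j (inj₁ (j , a))

  corner-of : ∀ {j j′ a} → InTriangle j′ (inj₁ (j , a)) → j′ ≡ j
  corner-of (corner _) = refl

  triangle-inside : ∀ {x y z} → x ~ y → y ~ z → x ~ z →
    ∃[ j ] InTriangle j x × InTriangle j y × InTriangle j z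
  triangle-inside (side _)       (side _)       (side _)       = _ , corner _ , corner _ , corner _
  triangle-inside (spoke refl)   (side a≢a)     (spoke refl)   = ⊥-elim (a≢a refl)
  triangle-inside (side a≢a)     (spoke⁻¹ refl) (spoke⁻¹ refl) = ⊥-elim (a≢a refl)
  triangle-inside (spoke⁻¹ refl) (spoke refl)   (side a≢a)     = ⊥-elim (a≢a refl)

  edge-inside : ∀ {j j′ x y} → InTriangle j x → InTriangle j′ y → x ~ y → j ≡ j′
  edge-inside (corner _) (corner _) (side _) = refl

  -- The value on apices is junk.
  position : Vertex → Fin 3
  position (inj₁ (_ , a)) = a
  position (inj₂ _)       = 0F

  at-most-three : ∀ {m j} (f : Fin m → Vertex) → Injective _≡_ _≡_ f → (∀ i → InTriangle j (f i)) → m ≤ 3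
  at-most-three f f-inj inside = injective⇒≤ (λ {i} {i′} eq → f-inj (same-corner (inside i) (inside i′) eq))
    where
    same-corner : ∀ {j x y} → InTriangle j x → InTriangle j y → position x ≡ position y → x ≡ y
    same-corner (corner a) (corner .a) refl = refl

  dumbbell-free : ¬ HasCopyᴿ (Dumbbell 3) _~_
  dumbbell-free (copy f f-inj f-edge)
    with j , c₀ , c₁ , c₂ ← triangle-inside (f-edge 0F 1F refl) (f-edge 1F 2F refl) (f-edge 0F 2F refl)
       | _ , c₃ , c₄ , c₅ ← triangle-inside (f-edge 3F 4F refl) (f-edge 4F 5F refl) (f-edge 3F 5F refl)
    with refl ← edge-inside c₀ c₃ (f-edge 0F 3F refl)
    = 6≰3 (at-most-three f f-inj inside)
    where
    inside : ∀ i → InTriangle j (f i)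
    inside 0F = c₀
    inside 1F = c₁
    inside 2F = c₂
    inside 3F = c₃
    inside 4F = c₄
    inside 5F = c₅
    6≰3 : ¬ 6 ≤ 3
    6≰3 (s≤s (s≤s (s≤s ())))

  codegree≤1 : ∀ {x y w w′} → x ≢ y → x ~ w → y ~ w → x ~ w′ → y ~ w′ → w ≡ w′
  codegree≤1 x≢y (side a≢c) (side b≢c) (side a≢d) (side b≢d) =
    cong (λ c → inj₁ (_ , c)) (Fin3-third-unique (x≢y ∘ cong (λ a → inj₁ (_ , a))) a≢c b≢c a≢d b≢d)
  codegree≤1 x≢y (spoke⁻¹ refl) (spoke⁻¹ refl) (side _) (side _) = ⊥-elim (x≢y refl)
  codegree≤1 x≢y (side _) (side _) (spoke⁻¹ refl) (spoke⁻¹ refl) = ⊥-elim (x≢y refl)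
  codegree≤1 {w = inj₂ s} {inj₂ t} x≢y (spoke⁻¹ refl) (spoke⁻¹ refl) (spoke⁻¹ p) (spoke⁻¹ q) with s ≟ t
  ... | yes refl = refl
  ... | no  s≢t  = ⊥-elim (x≢y (cong (λ j → inj₁ (j , T s j)) (common-unique s≢t (sym p) (sym q))))
  codegree≤1 x≢y (side _) (spoke refl) (side _) (spoke refl) = refl
  codegree≤1 x≢y (spoke refl) (side _) (spoke refl) (side _) = refl
  codegree≤1 x≢y (spoke refl) (spoke p) (spoke refl) (spoke q) =
    cong (λ j → inj₁ (j , T _ j)) (common-unique (x≢y ∘ cong inj₂) (sym p) (sym q))

  -- transpose 0F a 0F reduces to a, so the listing starts at corner a.
  triangle-from : Fin K → Fin 3 → Fin 3 → Vertex
  triangle-from j a x = inj₁ (j , transpose 0F a x)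

  triangle-clique : ∀ j a → IsClique _~_ (triangle-from j a)
  triangle-clique j a =
    clique (transpose-injective 0F a ∘ cong position) (side ∘ (_∘ transpose-injective 0F a))

  different-triangles : ∀ {j j′ a b} → j ≢ j′ → _≢_ {A = Vertex} (inj₁ (j , a)) (inj₁ (j′ , b))
  different-triangles j≢j′ refl = j≢j′ refl

  bridged-from-apex : ∀ {u v} s j {g : Fin 3 → Vertex} → IsClique (WithEdge _~_ u v) g → g 0F ≡ inj₂ s →
    (∀ x → ¬ InTriangle j (g x)) → HasCopyᴿ (Dumbbell 3) (WithEdge _~_ u v)
  bridged-from-apex {u} {v} s j g-clique g₀≡s outside =
    dumbbell-copy (WithEdge-sym ~-sym) g-clique (clique-mono old (triangle-clique j (T s j)))
      (λ x y eq → outside x (subst (InTriangle j) (sym eq) (corner _)))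
      (subst (λ w → WithEdge _~_ u v w (triangle-from j (T s j) 0F)) (sym g₀≡s) (old (spoke refl)))

  apex-to-corner : ∀ {s j a} → a ≢ T s j → HasCopyᴿ (Dumbbell 3) (WithEdge _~_ (inj₂ s) (inj₁ (j , a)))
  apex-to-corner {s} {j} {a} a≢c =
    bridged-from-apex s (other j) (lookup-clique (WithEdge-sym ~-sym) {xs} pairs) refl outside
    where
    xs : Vec Vertex 3
    xs = inj₂ s ∷ inj₁ (j , T s j) ∷ inj₁ (j , a) ∷ []
    pairs : AllPairs (λ x y → x ≢ y × WithEdge _~_ (inj₂ s) (inj₁ (j , a)) x y) xs
    pairs = (((λ ()) , old (spoke refl)) ∷ ((λ ()) , new) ∷ [])
          ∷ ((a≢c ∘ sym ∘ cong position , old (side (a≢c ∘ sym))) ∷ [])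
          ∷ [] ∷ []
    outside : ∀ x → ¬ InTriangle (other j) (lookup xs x)
    outside 0F = λ ()
    outside 1F = other-≢ j ∘ corner-of
    outside 2F = other-≢ j ∘ corner-of

  apex-to-apex : ∀ {s t} → s ≢ t → HasCopyᴿ (Dumbbell 3) (WithEdge _~_ (inj₂ s) (inj₂ t))
  apex-to-apex {s} {t} s≢t with j , meet ← common s t =
    bridged-from-apex s (other j) (lookup-clique (WithEdge-sym ~-sym) {xs} pairs) refl outside
    where
    xs : Vec Vertex 3
    xs = inj₂ s ∷ inj₂ t ∷ inj₁ (j , T s j) ∷ []
    pairs : AllPairs (λ x y → x ≢ y × WithEdge _~_ (inj₂ s) (inj₂ t) x y) xs
    pairs = ((s≢t ∘ inj₂-injective , new) ∷ ((λ ()) , old (spoke refl)) ∷ [])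
          ∷ (((λ ()) , old (spoke (sym meet))) ∷ [])
          ∷ [] ∷ []
    outside : ∀ x → ¬ InTriangle (other j) (lookup xs x)
    outside 0F = λ ()
    outside 1F = λ ()
    outside 2F = other-≢ j ∘ corner-of

  corner-to-corner : ∀ {j a j′ b} → j ≢ j′ →
    HasCopyᴿ (Dumbbell 3) (WithEdge _~_ (inj₁ (j , a)) (inj₁ (j′ , b)))
  corner-to-corner {j} {a} {j′} {b} j≢j′ =
    dumbbell-copy (WithEdge-sym ~-sym)
      (clique-mono old (triangle-clique j a)) (clique-mono old (triangle-clique j′ b))
      (λ _ _ → different-triangles j≢j′) new

  dumbbell-saturated : Saturatedᴿ (Dumbbell 3) _~_
  dumbbell-saturated = dumbbell-free , add-edge
    where
    add-edge : ∀ {u v} → u ≢ v → ¬ u ~ v → HasCopyᴿ (Dumbbell 3) (WithEdge _~_ u v)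
    add-edge {inj₁ (j , a)} {inj₁ (j′ , b)} u≢v u≁v with j ≟ j′
    ... | yes refl = ⊥-elim (u≁v (side (u≢v ∘ cong (λ c → inj₁ (j , c)))))
    ... | no j≢j′  = corner-to-corner j≢j′
    add-edge {inj₂ s} {inj₁ (j , a)} _ u≁v = apex-to-corner (u≁v ∘ spoke ∘ sym)
    add-edge {inj₁ (j , a)} {inj₂ s} _ u≁v = copy-mono WithEdge-swap (apex-to-corner (u≁v ∘ spoke⁻¹ ∘ sym))
    add-edge {inj₂ s} {inj₂ t} u≢v _ = apex-to-apex (u≢v ∘ cong inj₂)

attachment : ∀ {q} → Fin 2 → Fin (2 + q) → Fin 3
attachment 0F _       = 0F
attachment 1F 0F      = 0F
attachment 1F (suc _) = 1F

attachment-first : ∀ {q} σ → attachment {q} σ 0F ≡ 0F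
attachment-first 0F = refl
attachment-first 1F = refl

attachment-common : ∀ {q} σ τ → ∃[ j ] attachment {q} σ j ≡ attachment τ j
attachment-common σ τ = 0F , trans (attachment-first σ) (sym (attachment-first τ))

attachments-agree⇒first : ∀ {q} {j : Fin (2 + q)} → attachment 0F j ≡ attachment 1F j → j ≡ 0F
attachments-agree⇒first {j = 0F} _ = refl

attachment-common-unique : ∀ {q} {σ τ : Fin 2} {j j′ : Fin (2 + q)} → σ ≢ τ →
  attachment σ j ≡ attachment τ j → attachment σ j′ ≡ attachment τ j′ → j ≡ j′
attachment-common-unique {σ = 0F} {0F} σ≢τ _ _ = ⊥-elim (σ≢τ refl)
attachment-common-unique {σ = 0F} {1F} _   p q =
  trans (attachments-agree⇒first p) (sym (attachments-agree⇒first q))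
attachment-common-unique {σ = 1F} {0F} _   p q =
  trans (attachments-agree⇒first (sym p)) (sym (attachments-agree⇒first (sym q)))
attachment-common-unique {σ = 1F} {1F} σ≢τ _ _ = ⊥-elim (σ≢τ refl)

next : ∀ {q} → Fin (2 + q) → Fin (2 + q)
next 0F      = 1F
next (suc _) = 0F

next-≢ : ∀ {q} (j : Fin (2 + q)) → next j ≢ j
next-≢ 0F      ()
next-≢ (suc _) ()

divide-into-triangles : ∀ {n} → 6 ≤ n → ∃₂ λ q e → e ≤ 2 × n ≡ (2 + q) * 3 + e
divide-into-triangles 6≤n with o , refl ← m≤n⇒∃[o]m+o≡n 6≤n =
  o / 3 , o % 3 , ≤-pred (m%n<n o 3) , cong (6 +_) (trans (m≡m%n+[m/n]*n o 3) (+-comm (o % 3) (o / 3 * 3)))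

triangles-graph : ∀ {n} → 6 ≤ n → Σ[ G ∈ Graph n ] (Saturated (Dumbbell 3) G × ¬ HasCopy (Cycle 4) G)
triangles-graph {n} 6≤n with q , e , e≤2 , n≡ ← divide-into-triangles 6≤n =
  graph , saturated dumbbell-saturated , copy-free (codegree≤1⇒C4-free codegree≤1)
  where
  open Triangles {2 + q} {e} (λ s → attachment (inject≤ s e≤2))
    (λ _ _ → attachment-common _ _)
    (λ s≢t → attachment-common-unique (s≢t ∘ inject≤-injective e≤2 e≤2 _ _))
    next next-≢
  labelling : Fin n ↔ Vertex
  labelling = subst (λ N → Fin N ↔ Vertex) (sym n≡) (↔-trans +↔⊎ (*↔× ⊎-↔ ↔-refl))
  open Relabel _~?_ ~-sym ~-irrefl labelling

proposition9p3 : (r : ℕ) → (r ≡ 2 ⊎ r ≡ 3) → (n : ℕ) → 2 * r ≤ n →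
    Σ[ G ∈ Graph n ] (Saturated (Dumbbell r) G × ¬ HasCopy (Cycle (r + 1)) G)
proposition9p3 .2 (inj₁ refl) n 4≤n = star-graph 4≤n
proposition9p3 .3 (inj₂ refl) n 6≤n = triangles-graph 6≤n
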